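{- For any vertices $a,b$ of the Shrikhande graph and any automorphism $\tau$ of the Shrikhande graph, the order of the element $a-b$ in $\mathbb{Z}_4^2$ equals the order of the element $\tau(a)-\tau(b)$.
   Context: The Shrikhande graph $\mathrm{Sh}$ is the Cayley graph on the group $\mathbb{Z}_4^2$ (elements written $ab$ with $a,b\in\mathbb{Z}_4$) with connection set $\{01,03,10,30,11,33\}$: vertices $x,y$ are adjacent iff $x-y$ lies in this set. An automorphism is an arbitrary graph automorphism (not necessarily a group automorphism). -}

module Defs where

open import Data.Nat using (ℕ; zero; suc; _<_)
open import Data.Nat.DivMod using (_%_)
open import Data.Fin using (Fin; toℕ; fromℕ<)
open import Data.Fin.Properties using ()
open import Data.Nat.DivMod using (m%n<n)
open import Data.Product using (_×_; _,_)
open import Data.Sum using (_⊎_)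
open import Relation.Binary.PropositionalEquality using (_≡_)
open import Function.Bundles using (_⤖_; _⇔_)
open import Relation.Nullary using (¬_)
open import Function.Bundles using (module Bijection)

ℤ₄ : Set
ℤ₄ = Fin 4

mod4 : ℕ → ℤ₄
mod4 n = fromℕ< (m%n<n n 4)

_+₄_ : ℤ₄ → ℤ₄ → ℤ₄
x +₄ y = mod4 (toℕ x Data.Nat.+ toℕ y)

-₄_ : ℤ₄ → ℤ₄
-₄ x = mod4 (4 Data.Nat.∸ toℕ x)

-- the group ℤ₄² ; an element ab is the pair (a , b)
G : Set
G = ℤ₄ × ℤ₄

0G : G
0G = (mod4 0 , mod4 0)

_+G_ : G → G → G
(a , b) +G (c , d) = (a +₄ c , b +₄ d)

-G_ : G → G
-G (a , b) = (-₄ a , -₄ b)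

_-G_ : G → G → G
x -G y = x +G (-G y)

_•_ : ℕ → G → G
zero • x = 0G
suc n • x = x +G (n • x)

IsOrder : G → ℕ → Set
IsOrder x n = (0 < n) × (n • x ≡ 0G) × (∀ m → 0 < m → m < n → ¬ (m • x ≡ 0G))

InS : G → Set
InS x = (x ≡ (mod4 0 , mod4 1)) ⊎ (x ≡ (mod4 0 , mod4 3)) ⊎ (x ≡ (mod4 1 , mod4 0))
      ⊎ (x ≡ (mod4 3 , mod4 0)) ⊎ (x ≡ (mod4 1 , mod4 1)) ⊎ (x ≡ (mod4 3 , mod4 3))

-- adjacency in the Shrikhande graph (Cayley graph Cay(ℤ₄², S))
Adj : G → G → Set
Adj x y = InS (x -G y)

record Automorphism : Set where
  field
    bij : G ⤖ G
  open Bijection bij public using (to)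
  field
    preserves : ∀ x y → Adj x y ⇔ Adj (to x) (to y)

module Submission where

-- The order of a - b in ℤ₄² can be read off from the Shrikhande graph alone:
--   * it is 1 exactly when a = b;
--   * otherwise it is 4 exactly when a and b are "linked": adjacent, or the two
--     tips of a diamond (they have two common neighbours that are adjacent);
--   * otherwise it is 2.
-- Call this graph-theoretic quantity graphOrder a b.  Since a graph automorphism τ
-- preserves equality, adjacency and diamonds in both directions, it preserves
-- graphOrder, hence the order of a - b.

open import Defs
open import Data.Nat using (ℕ; _<_)
open import Data.Nat.Properties using (<-cmp; _<?_)
import Data.Nat.Properties as ℕ
open import Data.Fin using (Fin; toℕ; fromℕ<)
open import Data.Fin.Properties using (all?; any?; toℕ-fromℕ<)
import Data.Fin.Properties as Fin
open import Data.Bool using (if_then_else_)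
open import Data.Product using (Σ; ∃; _×_; _,_)
open import Data.Product.Properties using (≡-dec)
open import Data.Sum using (_⊎_)
import Data.Sum as Sum
open import Data.Empty using (⊥-elim)
open import Function.Bundles using (_⇔_; mk⇔; module Equivalence; module Bijection)
import Function.Properties.Equivalence as ⇔
open import Relation.Nullary using (¬_; Dec; does)
open import Relation.Nullary.Decidable
  using (map′; from-yes; does-⇔; _×-dec_; _⊎-dec_; _→-dec_; ¬?)
open import Relation.Binary.Definitions using (tri<; tri≈; tri>)
open import Relation.Binary.PropositionalEquality
  using (_≡_; refl; sym; cong; cong₂; subst; module ≡-Reasoning)

_≟G_ : (x y : G) → Dec (x ≡ y)
_≟G_ = ≡-dec Fin._≟_ Fin._≟_

∀G? : {P : G → Set} → (∀ x → Dec (P x)) → Dec (∀ x → P x)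
∀G? P? = map′ (λ f (a , b) → f a b) (λ f a b → f (a , b))
              (all? λ a → all? λ b → P? (a , b))

∃G? : {P : G → Set} → (∀ x → Dec (P x)) → Dec (∃ P)
∃G? P? = map′ (λ (a , b , p) → (a , b) , p) (λ ((a , b) , p) → a , b , p)
              (any? λ a → any? λ b → P? (a , b))

InS? : ∀ d → Dec (InS d)
InS? d = d ≟G _ ⊎-dec d ≟G _ ⊎-dec d ≟G _ ⊎-dec d ≟G _ ⊎-dec d ≟G _ ⊎-dec d ≟G _

Adj? : ∀ x y → Dec (Adj x y)
Adj? x y = InS? (x -G y)

-- The order of an element of ℤ₄².  The group has exponent 4, so the order is 1
-- for the identity, 2 if doubling kills the element, and 4 otherwise.

order : G → ℕ
order d = if does (d ≟G 0G) then 1 else if does ((2 • d) ≟G 0G) then 2 else 4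

IsOrder-unique : ∀ {d m n} → IsOrder d m → IsOrder d n → m ≡ n
IsOrder-unique {m = m} {n} (0<m , md≡0 , below-m) (0<n , nd≡0 , below-n) with <-cmp m n
... | tri< m<n _ _ = ⊥-elim (below-n m 0<m m<n md≡0)
... | tri≈ _ m≡n _ = m≡n
... | tri> _ _ n<m = ⊥-elim (below-m n 0<n n<m nd≡0)

order-isOrder : ∀ d → IsOrder d (order d)
order-isOrder d = positive d , annihilates d , minimal
  where
  positive : ∀ e → 0 < order e
  positive = from-yes (∀G? λ e → 0 <? order e)

  annihilates : ∀ e → order e • e ≡ 0G
  annihilates = from-yes (∀G? λ e → (order e • e) ≟G 0G)

  minimal-below : ∀ e (i : Fin (order e)) → 0 < toℕ i → ¬ (toℕ i • e ≡ 0G)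
  minimal-below = from-yes (∀G? λ e → all? λ (i : Fin (order e)) →
                                        0 <? toℕ i →-dec ¬? ((toℕ i • e) ≟G 0G))

  minimal : ∀ m → 0 < m → m < order d → ¬ (m • d ≡ 0G)
  minimal m 0<m m<o = subst (λ k → 0 < k → ¬ (k • d ≡ 0G)) (toℕ-fromℕ< m<o)
                            (minimal-below d (fromℕ< m<o)) 0<m

isOrder⇔ : ∀ d n → IsOrder d n ⇔ order d ≡ n
isOrder⇔ d n = mk⇔ (IsOrder-unique (order-isOrder d)) λ { refl → order-isOrder d }

CommonNeighbour : G → G → G → Set
CommonNeighbour x y u = Adj x u × Adj u y

Diamond : G → G → Set
Diamond x y = Σ G λ u → Σ G λ v → CommonNeighbour x y u × CommonNeighbour x y v × Adj u v

Linked : G → G → Set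
Linked x y = Adj x y ⊎ Diamond x y

Linked? : ∀ x y → Dec (Linked x y)
Linked? x y = Adj? x y ⊎-dec (∃G? λ u → ∃G? λ v →
  (Adj? x u ×-dec Adj? u y) ×-dec (Adj? x v ×-dec Adj? v y) ×-dec Adj? u v)

graphOrder : G → G → ℕ
graphOrder x y = if does (x ≟G y) then 1 else if does (Linked? x y) then 4 else 2

-- The combinatorial heart, checked over all 256 pairs: a difference in the
-- connection set has order 4; a non-adjacent pair at order-4 difference spans a
-- diamond; the common neighbours of a pair at order-2 difference are pairwise
-- non-adjacent.
order≡graphOrder : ∀ x y → order (x -G y) ≡ graphOrder x y
order≡graphOrder = from-yes (∀G? λ x → ∀G? λ y → order (x -G y) ℕ.≟ graphOrder x y)

-- Automorphisms preserve every notion graphOrder is built from, in both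
-- directions; surjectivity is what lets diamonds be pulled back.
module Invariance (τ : Automorphism) where
  open Automorphism τ using (to; bij; preserves)
  open Bijection bij using (injective; strictlySurjective)

  adj-push : ∀ {x y} → Adj x y → Adj (to x) (to y)
  adj-push {x} {y} = Equivalence.to (preserves x y)

  adj-pull : ∀ {x y} → Adj (to x) (to y) → Adj x y
  adj-pull {x} {y} = Equivalence.from (preserves x y)

  ≡⇔ : ∀ x y → (x ≡ y) ⇔ (to x ≡ to y)
  ≡⇔ x y = mk⇔ (cong to) injective

  diamond-push : ∀ {x y} → Diamond x y → Diamond (to x) (to y)
  diamond-push (u , v , (xu , uy) , (xv , vy) , uv) =
    to u , to v , (adj-push xu , adj-push uy) , (adj-push xv , adj-push vy) , adj-push uv

  diamond-pull : ∀ {x y} → Diamond (to x) (to y) → Diamond x y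
  diamond-pull (u , v , _) with strictlySurjective u | strictlySurjective v
  diamond-pull (_ , _ , (xu , uy) , (xv , vy) , uv) | u₀ , refl | v₀ , refl =
    u₀ , v₀ , (adj-pull xu , adj-pull uy) , (adj-pull xv , adj-pull vy) , adj-pull uv

  linked⇔ : ∀ x y → Linked x y ⇔ Linked (to x) (to y)
  linked⇔ x y = mk⇔ (Sum.map adj-push diamond-push) (Sum.map adj-pull diamond-pull)

  -- graphOrder only asks questions whose answers τ does not change.
  graphOrder-invariant : ∀ x y → graphOrder x y ≡ graphOrder (to x) (to y)
  graphOrder-invariant x y =
    cong₂ (λ same linked → if same then 1 else if linked then 4 else 2)
          (does-⇔ (≡⇔ x y) (x ≟G y) (to x ≟G to y))
          (does-⇔ (linked⇔ x y) (Linked? x y) (Linked? (to x) (to y)))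

  order-invariant : ∀ x y → order (x -G y) ≡ order (to x -G to y)
  order-invariant x y = begin
    order (x -G y)            ≡⟨ order≡graphOrder x y ⟩
    graphOrder x y            ≡⟨ graphOrder-invariant x y ⟩
    graphOrder (to x) (to y)  ≡⟨ sym (order≡graphOrder (to x) (to y)) ⟩
    order (to x -G to y)      ∎
    where open ≡-Reasoning

lemma2 : (a b : G) (τ : Automorphism) (n : ℕ) →
         IsOrder (a -G b) n ⇔ IsOrder (Automorphism.to τ a -G Automorphism.to τ b) n
lemma2 a b τ n =
  ⇔.trans (isOrder⇔ (a -G b) n)
    (subst (λ k → (k ≡ n) ⇔ IsOrder (to a -G to b) n)
           (sym (order-invariant a b))
           (⇔.sym (isOrder⇔ (to a -G to b) n)))
  where
  open Automorphism τ using (to)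
  open Invariance τ using (order-invariant)
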